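{- Let $(x,y,z,m,n)$ be a nontrivial solution in positive integers with $x>y$ of $\phi\left(z\frac{x^m-y^m}{x-y}\right)=z\frac{x^n-y^n}{x-y}$ such that $1\le z\le x-y$ and $\gcd(m,n)=1$. Let $d_1=\gcd(x,y)$, $x_1=x/d_1$, $y_1=y/d_1$. If $x\le 80$ and $d$ is a divisor of $m$ whose least prime divisor $p(d)$ satisfies $p(d)\ge 173$, then $$\log\prod_{\ell_p=d}\left(1+\frac1{p-1}\right)<0.032,$$ the product running over odd primes $p\nmid x_1y_1$ with $\ell_p=d$.
   Context: $\phi$ is Euler's totient function. A solution $(x,y,z,m,n)$ of this equation in positive integers with $x>y$ is trivial if it equals $(a,b,1,1,1)$ for integers $a>b\ge1$; otherwise nontrivial. For an odd prime $p$ with $p\nmid x_1y_1$, $\ell_p$ denotes the least positive integer $\ell$ such that $p\mid x_1^\ell-y_1^\ell$. -}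

module Defs where

open import Data.Nat using (ℕ; zero; suc; _+_; _*_; _∸_; _^_; _≤_; _<_)
open import Data.Nat using (_!)
open import Data.Nat.DivMod using (_/_)
open import Data.Nat.GCD using (gcd)
open import Data.Nat.Divisibility using (_∣_)
open import Data.Nat.Primality using (Prime)
open import Data.Integer using (+_)
open import Data.Rational as ℚ using (ℚ; 0ℚ; 1ℚ)
open import Data.List using (List; []; _∷_)
open import Data.Product using (_×_; ∃)
open import Relation.Nullary using (¬_)
open import Relation.Binary.PropositionalEquality using (_≡_)
import Data.Nat as ℕ

countCoprime : ℕ → ℕ → ℕ
countCoprime n zero = 0
countCoprime n (suc k) with gcd (suc k) n ℕ.≟ 1
... | Relation.Nullary.yes _ = suc (countCoprime n k)
... | Relation.Nullary.no  _ = countCoprime n k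

φ : ℕ → ℕ
φ n = countCoprime n n

_div_ : ℕ → ℕ → ℕ
a div zero = 0
a div suc b = a / suc b

recipℚ : ℕ → ℚ
recipℚ zero = 0ℚ
recipℚ (suc k) = + 1 ℚ./ suc k

U : ℕ → ℕ → ℕ → ℕ
U x y k = (x ^ k ∸ y ^ k) div (x ∸ y)

IsLeastOrder : ℕ → ℕ → ℕ → ℕ → Set
IsLeastOrder a b p ℓ =
  (1 ≤ ℓ) × (p ∣ (a ^ ℓ ∸ b ^ ℓ)) ×
  (∀ k → 1 ≤ k → k < ℓ → ¬ (p ∣ (a ^ k ∸ b ^ k)))

IsLeastPrimeDivisor : ℕ → ℕ → Set
IsLeastPrimeDivisor q d = Prime q × q ∣ d × (∀ r → Prime r → r ∣ d → q ≤ r)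

prodFactor : List ℕ → ℚ
prodFactor [] = 1ℚ
prodFactor (p ∷ L) = (1ℚ ℚ.+ recipℚ (p ∸ 1)) ℚ.* prodFactor L

powℚ : ℚ → ℕ → ℚ
powℚ c zero = 1ℚ
powℚ c (suc k) = c ℚ.* powℚ c k

expPartial : ℚ → ℕ → ℚ
expPartial c zero = 1ℚ
expPartial c (suc N) = expPartial c N ℚ.+ powℚ c (suc N) ℚ.* recipℚ (suc N !)

-- For q > 0 and c ≥ 0:  log q < c  ⇔  q < e^c  ⇔  q < some partial sum of the
-- (strictly increasing, convergent to e^c) exponential series.
LogLt : ℚ → ℚ → Set
LogLt q c = ∃ λ N → q ℚ.< expPartial c N

{-# OPTIONS --safe #-}
module Submission where

-- For a prime p with ℓ_p = d, the residue x₁/y₁ has order d modulo p, so d ∣ p − 1 by Fermat;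
-- as d is odd, p = 1 + 2dj with j ≥ 1. These primes are distinct divisors of x₁^d − y₁^d < 80^d.
-- At most d/2 of them exceed 64d, because (64d + 1)^k ≤ 80^d; by Bernoulli they contribute
-- a factor at most 128/127. The others have j ≤ 31, so they contribute at most
-- ∏_{j ≤ 31} (1 + 1/(2dj)), which is largest at d = 173; a direct computation shows that the
-- two bounds together stay below 129/125 = 1 + 0.032 < e^0.032.

open import Defs
open import Data.Nat hiding (_/_)
import Data.Nat as ℕ using (_/_)
open import Data.Nat.Properties
open import Data.Nat.DivMod hiding (_/_; _div_)
open import Data.Nat.Divisibility
open import Data.Nat.GCD using (gcd; gcd[m,n]∣m; gcd[m,n]∣n)
open import Data.Nat.Primality
open import Data.Nat.Primality.Factorisation using (factorisationHasAllPrimeFactors)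
open import Data.Nat.Combinatorics using (_C_; nCk≡n!/k![n-k]!; k![n∸k]!∣n!; nCn≡1)
open import Data.Nat.ListAction using (product)
open import Data.Nat.ListAction.Properties using (product-++; product-↭; product≢0)
open import Data.Fin as Fin using (Fin; toℕ; fromℕ; inject₁)
open import Data.Fin.Properties using (toℕ<n; toℕ-inject₁; toℕ-fromℕ)
open import Data.Integer as ℤ using (+_)
import Data.Integer.Properties as ℤP
open import Data.Rational as ℚ using (_/_; toℚᵘ; 1ℚ)
import Data.Rational.Properties as ℚP
open import Data.Rational.Unnormalised as ℚᵘ using (ℚᵘ; mkℚᵘ; ↥_; ↧_; ↧ₙ_)
import Data.Rational.Unnormalised.Properties as ℚᵘP
open import Data.List using (List; []; _∷_; _++_; map; filter; upTo; length)
open import Data.List.Properties using (map-++)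
open import Data.List.Membership.Propositional using (_∈_)
open import Data.List.Membership.Propositional.Properties using (∈-filter⁻; ∈-map⁺; ∈-upTo⁺)
open import Data.List.Relation.Binary.Subset.Propositional using (_⊆_)
open import Data.List.Relation.Binary.Permutation.Propositional using (_↭_; refl; prep; ↭-trans; ↭-sym)
open import Data.List.Relation.Binary.Permutation.Propositional.Properties using (shift; map⁺)
open import Data.List.Relation.Unary.All as All using (All; []; _∷_)
import Data.List.Relation.Unary.All.Properties as AllP
open import Data.List.Relation.Unary.Any using (here; there)
open import Data.List.Relation.Unary.AllPairs using ([]; _∷_)
open import Data.List.Relation.Unary.Unique.Propositional using (Unique)
import Data.List.Relation.Unary.Unique.Propositional.Properties as Unique
open import Data.Product using (_×_; _,_; proj₁; proj₂)
open import Data.Sum using (_⊎_; inj₁; inj₂; [_,_]′)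
open import Function using (_∘_; id; flip)
open import Function.Bundles using (_⇔_; Equivalence)
open import Level using (0ℓ)
open import Relation.Nullary using (¬_; yes; no; ¬?; contradiction)
open import Relation.Nullary.Decidable using (toWitness)
open import Relation.Unary using (Pred; Decidable)
open import Relation.Binary.PropositionalEquality
  using (_≡_; _≢_; refl; sym; trans; cong; cong₂; subst; subst₂; module ≡-Reasoning)
import Algebra.Properties.CommutativeSemiring.Binomial +-*-commutativeSemiring as Binomial
import Algebra.Properties.CommutativeSemiring.Exp +-*-commutativeSemiring as Exp
import Algebra.Properties.Monoid.Sum +-0-monoid as Sum
open import Algebra.Definitions.RawMonoid +-0-rawMonoid using (sum) renaming (_×_ to _×ₙ_)
open import Algebra.Properties.Semiring.Exp +-*-semiring using () renaming (_^_ to _^ₛ_)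
open import Algebra.Properties.CommutativeSemigroup +-commutativeSemigroup
  using () renaming (x∙yz≈y∙xz to m+[n+o]≡n+[m+o])
open import Algebra.Properties.CommutativeSemigroup *-commutativeSemigroup
  using (interchange) renaming ( xy∙z≈xz∙y to m*n*o≡m*o*n; xy∙z≈y∙xz to m*n*o≡n*[m*o]
                               ; xy∙z≈x∙zy to m*n*o≡m*[o*n]; x∙yz≈y∙xz to m*[n*o]≡n*[m*o]
                               ; x∙yz≈y∙zx to m*[n*o]≡n*[o*m])
import Algebra.Properties.CommutativeSemigroup ℤP.*-commutativeSemigroup as ℤ*

-- Congruences, Fermat's little theorem and multiplicative orders

module Modular (p : ℕ) .{{_ : NonZero p}} where

  ∣∸⇒%≡ : ∀ {m n} → n ≤ m → p ∣ m ∸ n → m % p ≡ n % p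
  ∣∸⇒%≡ {m} {n} n≤m (divides q m∸n≡q*p) = begin
    m % p               ≡⟨ cong (_% p) (m+[n∸m]≡n n≤m) ⟨
    (n + (m ∸ n)) % p   ≡⟨ cong (λ k → (n + k) % p) m∸n≡q*p ⟩
    (n + q * p) % p     ≡⟨ [m+kn]%n≡m%n n q p ⟩
    n % p               ∎
    where open ≡-Reasoning

  %≡⇒∣∸ : ∀ {m n} → n ≤ m → m % p ≡ n % p → p ∣ m ∸ n
  %≡⇒∣∸ {m} {n} n≤m m≡n = divides (m ℕ./ p ∸ n ℕ./ p) (begin
    m ∸ n
      ≡⟨ cong₂ _∸_ (m≡m%n+[m/n]*n m p) (m≡m%n+[m/n]*n n p) ⟩
    (m % p + m ℕ./ p * p) ∸ (n % p + n ℕ./ p * p)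
      ≡⟨ cong (λ r → (r + _) ∸ (n % p + n ℕ./ p * p)) m≡n ⟩
    (n % p + m ℕ./ p * p) ∸ (n % p + n ℕ./ p * p)   ≡⟨ [m+n]∸[m+o]≡n∸o (n % p) _ _ ⟩
    m ℕ./ p * p ∸ n ℕ./ p * p                       ≡⟨ *-distribʳ-∸ p (m ℕ./ p) (n ℕ./ p) ⟨
    (m ℕ./ p ∸ n ℕ./ p) * p                         ∎)
    where open ≡-Reasoning

  %-cong-* : ∀ {m m′ n n′} → m % p ≡ m′ % p → n % p ≡ n′ % p → (m * n) % p ≡ (m′ * n′) % p
  %-cong-* {m} {m′} {n} {n′} m≡m′ n≡n′ = begin
    (m * n) % p               ≡⟨ %-distribˡ-* m n p ⟩
    ((m % p) * (n % p)) % p   ≡⟨ cong₂ (λ a b → (a * b) % p) m≡m′ n≡n′ ⟩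
    ((m′ % p) * (n′ % p)) % p ≡⟨ %-distribˡ-* m′ n′ p ⟨
    (m′ * n′) % p             ∎
    where open ≡-Reasoning

  %-cong-^ : ∀ {m n} k → m % p ≡ n % p → (m ^ k) % p ≡ (n ^ k) % p
  %-cong-^ zero    _   = refl
  %-cong-^ (suc k) m≡n = %-cong-* m≡n (%-cong-^ k m≡n)

^ₛ≡^ : ∀ m n → m ^ₛ n ≡ m ^ n
^ₛ≡^ m zero    = refl
^ₛ≡^ m (suc n) = cong (m *_) (^ₛ≡^ m n)

×ₙ≡* : ∀ m n → m ×ₙ n ≡ m * n
×ₙ≡* zero    n = refl
×ₙ≡* (suc m) n = cong (_+_ n) (×ₙ≡* m n)

^-distribʳ-* : ∀ m n k → (m * n) ^ k ≡ m ^ k * n ^ k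
^-distribʳ-* m n k = begin
  (m * n) ^ k          ≡⟨ ^ₛ≡^ (m * n) k ⟨
  (m * n) ^ₛ k         ≡⟨ Exp.^-distrib-* m n k ⟩
  m ^ₛ k * n ^ₛ k      ≡⟨ cong₂ _*_ (^ₛ≡^ m k) (^ₛ≡^ n k) ⟩
  m ^ k * n ^ k        ∎
  where open ≡-Reasoning

∣-nonZero : ∀ {m n} .{{_ : NonZero n}} → m ∣ n → NonZero m
∣-nonZero {zero}  0∣n = contradiction (0∣⇒≡0 0∣n) (≢-nonZero⁻¹ _)
∣-nonZero {suc m} _   = _

n∣n! : ∀ n → .{{NonZero n}} → n ∣ n !
n∣n! (suc n) = m∣m*n (n !)

sum-∣ : ∀ {d k} (f : Fin k → ℕ) → (∀ i → d ∣ f i) → d ∣ sum f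
sum-∣ {k = zero}  f d∣f = _ ∣0
sum-∣ {k = suc k} f d∣f = ∣m∣n⇒∣m+n (d∣f Fin.zero) (sum-∣ (f ∘ Fin.suc) (d∣f ∘ Fin.suc))

freshmansDream : ∀ {d} .{{_ : NonZero d}} n m → .{{NonZero n}} →
                 (∀ k → 0 < k → k < n → d ∣ n C k) → ((m + 1) ^ n) % d ≡ (1 + m ^ n) % d
freshmansDream {d} n@(suc q) m d∣inner-C = begin
    ((m + 1) ^ n) % d              ≡⟨ cong (_% d) expansion ⟩
    (sum inner + (1 + m ^ n)) % d  ≡⟨ %-remove-+ˡ (1 + m ^ n) (sum-∣ inner d∣inner) ⟩
    (1 + m ^ n) % d                ∎
  where
  open ≡-Reasoning
  t : Fin (suc n) → ℕ
  t = Binomial.binomialTerm m 1 n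
  inner : Fin q → ℕ
  inner i = t (Fin.suc (inject₁ i))
  d∣inner : ∀ i → d ∣ inner i
  d∣inner i = subst (d ∣_) (sym (×ₙ≡* (n C suc k) _))
                    (∣m⇒∣m*n _ (d∣inner-C (suc k) (s≤s z≤n) (s≤s k<q)))
    where
    k = toℕ (inject₁ i)
    k<q : k < q
    k<q = subst (_< q) (sym (toℕ-inject₁ i)) (toℕ<n i)
  first : t Fin.zero ≡ 1
  first = begin
    (n C 0) ×ₙ (1 * 1 ^ₛ n)  ≡⟨ +-identityʳ _ ⟩
    1 * 1 ^ₛ n               ≡⟨ *-identityˡ _ ⟩
    1 ^ₛ n                   ≡⟨ ^ₛ≡^ 1 n ⟩
    1 ^ n                    ≡⟨ ^-zeroˡ n ⟩
    1                        ∎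
  last : t (Fin.suc (fromℕ q)) ≡ m ^ n
  last = begin
    t (Fin.suc (fromℕ q))
      ≡⟨ cong (λ k → (n C suc k) ×ₙ (m ^ₛ suc k * 1 ^ₛ (q ∸ k))) (toℕ-fromℕ q) ⟩
    (n C n) ×ₙ (m ^ₛ n * 1 ^ₛ (q ∸ q))
      ≡⟨ cong₂ (λ c e → c ×ₙ (m ^ₛ n * 1 ^ₛ e)) (nCn≡1 n) (n∸n≡0 q) ⟩
    1 ×ₙ (m ^ₛ n * 1)                   ≡⟨ +-identityʳ _ ⟩
    m ^ₛ n * 1                          ≡⟨ *-identityʳ _ ⟩
    m ^ₛ n                              ≡⟨ ^ₛ≡^ m n ⟩
    m ^ n                               ∎
  expansion : (m + 1) ^ n ≡ sum inner + (1 + m ^ n)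
  expansion = begin
    (m + 1) ^ n
      ≡⟨ ^ₛ≡^ (m + 1) n ⟨
    (m + 1) ^ₛ n
      ≡⟨ Binomial.theorem n m 1 ⟩
    t Fin.zero + sum (t ∘ Fin.suc)
      ≡⟨ cong (_+_ (t Fin.zero)) (Sum.sum-init-last (t ∘ Fin.suc)) ⟩
    t Fin.zero + (sum inner + t (Fin.suc (fromℕ q)))
      ≡⟨ cong₂ (λ a b → a + (sum inner + b)) first last ⟩
    1 + (sum inner + m ^ n)
      ≡⟨ m+[n+o]≡n+[m+o] 1 (sum inner) (m ^ n) ⟩
    sum inner + (1 + m ^ n)
      ∎

2∣n⊎2∣1+n : ∀ n → 2 ∣ n ⊎ 2 ∣ suc n
2∣n⊎2∣1+n zero    = inj₁ (2 ∣0)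
2∣n⊎2∣1+n (suc n) = [ inj₂ ∘ ∣m∣n⇒∣m+n (∣-refl {2}) , inj₁ ]′ (2∣n⊎2∣1+n n)

prime≢2⇒2∣p∸1 : ∀ {p} → Prime p → p ≢ 2 → 2 ∣ p ∸ 1
prime≢2⇒2∣p∸1 {suc p} p-prime p≢2 = [ id , flip contradiction 2∤1+p ]′ (2∣n⊎2∣1+n p)
  where
  2∤1+p : ¬ 2 ∣ suc p
  2∤1+p 2∣1+p = [ (λ ()) , p≢2 ∘ sym ]′ (prime⇒irreducible p-prime 2∣1+p)

2*-∣-of-odd : ∀ {d n} → ¬ 2 ∣ d → d ∣ n → 2 ∣ n → 2 * d ∣ n
2*-∣-of-odd {d} 2∤d (divides t n≡td) 2∣n with euclidsLemma t d prime[2] (subst (2 ∣_) n≡td 2∣n)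
... | inj₂ 2∣d              = contradiction 2∣d 2∤d
... | inj₁ (divides u t≡u2) = divides u (trans n≡td (trans (cong (_* d) t≡u2) (*-assoc u 2 d)))

module _ {p : ℕ} (p-prime : Prime p) where

  private instance
    p≢0 : NonZero p
    p≢0 = prime⇒nonZero p-prime

  open Modular p

  prime⇒2≤ : 2 ≤ p
  prime⇒2≤ = nonTrivial⇒n>1 p {{prime⇒nonTrivial p-prime}}

  prime∤1 : ¬ p ∣ 1
  prime∤1 p∣1 = <⇒≢ prime⇒2≤ (sym (∣1⇒≡1 p∣1))

  prime∤^ : ∀ {m} k → ¬ p ∣ m → ¬ p ∣ m ^ k
  prime∤^ zero        _   = prime∤1
  prime∤^ {m} (suc k) p∤m p∣m*m^k with euclidsLemma m (m ^ k) p-prime p∣m*m^k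
  ... | inj₁ p∣m   = p∤m p∣m
  ... | inj₂ p∣m^k = prime∤^ k p∤m p∣m^k

  prime∤! : ∀ {k} → k < p → ¬ p ∣ k !
  prime∤! {zero}  _   = prime∤1
  prime∤! {suc k} k<p p∣k! with euclidsLemma (suc k) (k !) p-prime p∣k!
  ... | inj₁ p∣1+k = <⇒≱ k<p (∣⇒≤ p∣1+k)
  ... | inj₂ p∣k!  = prime∤! (<-trans (n<1+n k) k<p) p∣k!

  prime∣pCk : ∀ {k} → 0 < k → k < p → p ∣ p C k
  prime∣pCk {k} 0<k k<p with euclidsLemma (p C k) (k ! * (p ∸ k) !) p-prime p∣C*k!*[p∸k]!
    where
    instance _ = k !* (p ∸ k) !≢0
    p∣C*k!*[p∸k]! : p ∣ (p C k) * (k ! * (p ∸ k) !)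
    p∣C*k!*[p∸k]! = subst (p ∣_) (sym (begin
      (p C k) * (k ! * (p ∸ k) !)
        ≡⟨ cong (_* (k ! * (p ∸ k) !)) (nCk≡n!/k![n-k]! (<⇒≤ k<p)) ⟩
      p ! ℕ./ (k ! * (p ∸ k) !) * (k ! * (p ∸ k) !)
        ≡⟨ m/n*n≡m (k![n∸k]!∣n! (<⇒≤ k<p)) ⟩
      p ! ∎)) (n∣n! p)
      where open ≡-Reasoning
  ... | inj₁ p∣C = p∣C
  ... | inj₂ p∣k!*[p∸k]! with euclidsLemma (k !) ((p ∸ k) !) p-prime p∣k!*[p∸k]!
  ...   | inj₁ p∣k!     = contradiction p∣k! (prime∤! k<p)
  ...   | inj₂ p∣[p∸k]! = contradiction p∣[p∸k]! (prime∤! (∸-monoʳ-< 0<k (<⇒≤ k<p)))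

  fermatsLittleTheorem : ∀ m → (m ^ p) % p ≡ m % p
  fermatsLittleTheorem zero    = cong (λ e → (0 ^ e) % p) (sym (suc-pred p))
  fermatsLittleTheorem (suc m) = begin
    (suc m ^ p) % p            ≡⟨ cong (λ k → (k ^ p) % p) (+-comm 1 m) ⟩
    ((m + 1) ^ p) % p          ≡⟨ freshmansDream p m (λ _ → prime∣pCk) ⟩
    (1 + m ^ p) % p            ≡⟨ %-distribˡ-+ 1 (m ^ p) p ⟩
    (1 % p + (m ^ p) % p) % p  ≡⟨ cong (λ r → (1 % p + r) % p) (fermatsLittleTheorem m) ⟩
    (1 % p + m % p) % p        ≡⟨ %-distribˡ-+ 1 m p ⟨
    suc m % p                  ∎
    where open ≡-Reasoning

  prime∤⇒∣*-cancelˡ : ∀ {c m} → ¬ p ∣ c → p ∣ c * m → p ∣ m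
  prime∤⇒∣*-cancelˡ {c} {m} p∤c p∣cm =
    [ flip contradiction p∤c , id ]′ (euclidsLemma c m p-prime p∣cm)

  prime∤⇒%-*-cancelˡ : ∀ {c m n} → ¬ p ∣ c → (c * m) % p ≡ (c * n) % p → m % p ≡ n % p
  prime∤⇒%-*-cancelˡ {c} {m} {n} p∤c cm≡cn =
    [ (λ n≤m → cancel n≤m cm≡cn) , (λ m≤n → sym (cancel m≤n (sym cm≡cn))) ]′ (≤-total n m)
    where
    cancel : ∀ {m n} → n ≤ m → (c * m) % p ≡ (c * n) % p → m % p ≡ n % p
    cancel {m} {n} n≤m cm≡cn = ∣∸⇒%≡ n≤m (prime∤⇒∣*-cancelˡ p∤c
      (subst (p ∣_) (sym (*-distribˡ-∸ c m n)) (%≡⇒∣∸ (*-monoʳ-≤ c n≤m) cm≡cn)))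

  fermatsLittleTheorem′ : ∀ {m} → ¬ p ∣ m → (m ^ (p ∸ 1)) % p ≡ 1 % p
  fermatsLittleTheorem′ {m} p∤m = prime∤⇒%-*-cancelˡ p∤m (begin
    (m * m ^ (p ∸ 1)) % p   ≡⟨ cong (λ e → (m ^ e) % p) (suc-pred p) ⟩
    (m ^ p) % p             ≡⟨ fermatsLittleTheorem m ⟩
    m % p                   ≡⟨ cong (_% p) (*-identityʳ m) ⟨
    (m * 1) % p             ∎)
    where open ≡-Reasoning

  leastOrder∣p∸1 : ∀ {a b d} → ¬ p ∣ a → ¬ p ∣ b → b ≤ a → IsLeastOrder a b p d → d ∣ p ∸ 1
  leastOrder∣p∸1 {a} {b} {d} p∤a p∤b b≤a (1≤d , p∣aᵈ∸bᵈ , least) = m%n≡0⇒n∣m (p ∸ 1) d r≡0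
    where
    instance
      d≢0 : NonZero d
      d≢0 = >-nonZero 1≤d
    open ≡-Reasoning
    r = (p ∸ 1) % d
    s = (p ∸ 1) ℕ./ d
    split : ∀ c → c ^ (p ∸ 1) ≡ (c ^ d) ^ s * c ^ r
    split c = begin
      c ^ (p ∸ 1)          ≡⟨ cong (c ^_) (m≡m%n+[m/n]*n (p ∸ 1) d) ⟩
      c ^ (r + s * d)      ≡⟨ ^-distribˡ-+-* c r (s * d) ⟩
      c ^ r * c ^ (s * d)  ≡⟨ *-comm (c ^ r) _ ⟩
      c ^ (s * d) * c ^ r  ≡⟨ cong (λ e → c ^ e * c ^ r) (*-comm s d) ⟩
      c ^ (d * s) * c ^ r  ≡⟨ cong (_* c ^ r) (^-*-assoc c d s) ⟨
      (c ^ d) ^ s * c ^ r  ∎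
    aᵈ≡bᵈ : (a ^ d) % p ≡ (b ^ d) % p
    aᵈ≡bᵈ = ∣∸⇒%≡ (^-monoˡ-≤ d b≤a) p∣aᵈ∸bᵈ
    aʳ≡bʳ : (a ^ r) % p ≡ (b ^ r) % p
    aʳ≡bʳ = prime∤⇒%-*-cancelˡ (prime∤^ s (prime∤^ d p∤b)) (begin
      ((b ^ d) ^ s * a ^ r) % p  ≡⟨ %-cong-* (%-cong-^ s aᵈ≡bᵈ) refl ⟨
      ((a ^ d) ^ s * a ^ r) % p  ≡⟨ cong (_% p) (split a) ⟨
      (a ^ (p ∸ 1)) % p          ≡⟨ fermatsLittleTheorem′ p∤a ⟩
      1 % p                      ≡⟨ fermatsLittleTheorem′ p∤b ⟨
      (b ^ (p ∸ 1)) % p          ≡⟨ cong (_% p) (split b) ⟩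
      ((b ^ d) ^ s * b ^ r) % p  ∎)
    r≡0 : r ≡ 0
    r≡0 with r ≟ 0
    ... | yes r≡0 = r≡0
    ... | no  r≢0 = contradiction (%≡⇒∣∸ (^-monoˡ-≤ r b≤a) aʳ≡bʳ)
                                  (least r (n≢0⇒n>0 r≢0) (m%n<n (p ∸ 1) d))

  leastOrder⇒2d∣p∸1 : ∀ {a b d} → ¬ 2 ∣ d → p ≢ 2 → ¬ p ∣ a * b → b ≤ a →
                      IsLeastOrder a b p d → 2 * d ∣ p ∸ 1
  leastOrder⇒2d∣p∸1 {a} {b} 2∤d p≢2 p∤ab b≤a order =
    2*-∣-of-odd 2∤d (leastOrder∣p∸1 (p∤ab ∘ ∣m⇒∣m*n b) (p∤ab ∘ ∣n⇒∣m*n a) b≤a order)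
                    (prime≢2⇒2∣p∸1 p-prime p≢2)

product-distinctPrimes-∣ : ∀ {n ps} → Unique ps → All Prime ps → All (_∣ n) ps → product ps ∣ n
product-distinctPrimes-∣ []                          []                   []           = 1∣ _
product-distinctPrimes-∣ {ps = p ∷ ps} (p∉ps ∷ ps!) (p-prime ∷ ps-prime) (p∣n ∷ ps∣n)
  with product-distinctPrimes-∣ ps! ps-prime ps∣n
... | divides k n≡k∏ps = subst (_ ∣_) (sym n≡k∏ps) (*-monoˡ-∣ (product ps) p∣k)
  where
  p∤∏ps : ¬ p ∣ product ps
  p∤∏ps p∣∏ps = AllP.All¬⇒¬Any p∉ps (factorisationHasAllPrimeFactors p-prime p∣∏ps ps-prime)
  p∣k : p ∣ k
  p∣k = [ id , flip contradiction p∤∏ps ]′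
          (euclidsLemma k (product ps) p-prime (subst (p ∣_) n≡k∏ps p∣n))

product-distinctPrimes-≤ : ∀ {a b c d ps} .{{_ : NonZero d}} → b < a → a ≤ c →
                           Unique ps → All Prime ps → All (_∣ a ^ d ∸ b ^ d) ps → product ps ≤ c ^ d
product-distinctPrimes-≤ {a} {b} {c} {d} {ps} b<a a≤c ps! ps-prime ps∣aᵈ∸bᵈ = begin
  product ps     ≤⟨ ∣⇒≤ {{>-nonZero (m<n⇒0<n∸m (^-monoˡ-< d b<a))}}
                        (product-distinctPrimes-∣ ps! ps-prime ps∣aᵈ∸bᵈ) ⟩
  a ^ d ∸ b ^ d  ≤⟨ m∸n≤m (a ^ d) (b ^ d) ⟩
  a ^ d          ≤⟨ ^-monoˡ-≤ d a≤c ⟩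
  c ^ d          ∎
  where open ≤-Reasoning

-- The products ∏ x / (x − 1) as fractions of naturals

infix 4 _≤ᶠ_ _<ᶠ_
infixl 7 _⊗_

-- A pair (a , b) stands for the fraction a / b.
data _≤ᶠ_ : ℕ × ℕ → ℕ × ℕ → Set where
  *≤* : ∀ {a b c d} → a * d ≤ c * b → (a , b) ≤ᶠ (c , d)

data _<ᶠ_ : ℕ × ℕ → ℕ × ℕ → Set where
  *<* : ∀ {a b c d} → a * d < c * b → (a , b) <ᶠ (c , d)

_⊗_ : ℕ × ℕ → ℕ × ℕ → ℕ × ℕ
(a , b) ⊗ (c , d) = a * c , b * d

≤ᶠ-trans : ∀ {a b c d e f} .{{_ : NonZero d}} →
           (a , b) ≤ᶠ (c , d) → (c , d) ≤ᶠ (e , f) → (a , b) ≤ᶠ (e , f)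
≤ᶠ-trans {a} {b} {c} {d} {e} {f} (*≤* ad≤cb) (*≤* cf≤ed) =
  *≤* (*-cancelʳ-≤ (a * f) (e * b) d (begin
  a * f * d  ≡⟨ m*n*o≡m*o*n a f d ⟩
  a * d * f  ≤⟨ *-monoˡ-≤ f ad≤cb ⟩
  c * b * f  ≡⟨ m*n*o≡m*o*n c b f ⟩
  c * f * b  ≤⟨ *-monoˡ-≤ b cf≤ed ⟩
  e * d * b  ≡⟨ m*n*o≡m*o*n e d b ⟩
  e * b * d  ∎))
  where open ≤-Reasoning

≤ᶠ-<ᶠ-trans : ∀ {a b c d e f} .{{_ : NonZero b}} .{{_ : NonZero d}} →
              (a , b) ≤ᶠ (c , d) → (c , d) <ᶠ (e , f) → (a , b) <ᶠ (e , f)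
≤ᶠ-<ᶠ-trans {a} {b} {c} {d} {e} {f} (*≤* ad≤cb) (*<* cf<ed) =
  *<* (*-cancelʳ-< d (a * f) (e * b) (begin-strict
  a * f * d  ≡⟨ m*n*o≡m*o*n a f d ⟩
  a * d * f  ≤⟨ *-monoˡ-≤ f ad≤cb ⟩
  c * b * f  ≡⟨ m*n*o≡m*o*n c b f ⟩
  c * f * b  <⟨ *-monoˡ-< b cf<ed ⟩
  e * d * b  ≡⟨ m*n*o≡m*o*n e d b ⟩
  e * b * d  ∎))
  where open ≤-Reasoning

⊗-mono-≤ᶠ : ∀ {x y u v} → x ≤ᶠ y → u ≤ᶠ v → x ⊗ u ≤ᶠ y ⊗ v
⊗-mono-≤ᶠ {a , b} {c , d} {e , f} {g , h} (*≤* ad≤cb) (*≤* eh≤gf) = *≤* (begin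
  a * e * (d * h)  ≡⟨ interchange a e d h ⟩
  a * d * (e * h)  ≤⟨ *-mono-≤ ad≤cb eh≤gf ⟩
  c * b * (g * f)  ≡⟨ interchange c b g f ⟩
  c * g * (b * f)  ∎)
  where open ≤-Reasoning

ratio : List ℕ → ℕ × ℕ
ratio xs = product xs , product (map (_∸ 1) xs)

ratio-++ : ∀ xs ys → ratio (xs ++ ys) ≡ ratio xs ⊗ ratio ys
ratio-++ xs ys = cong₂ _,_ (product-++ xs ys)
  (trans (cong product (map-++ (_∸ 1) xs ys)) (product-++ (map (_∸ 1) xs) (map (_∸ 1) ys)))

ratio-↭ : ∀ {xs ys} → xs ↭ ys → ratio xs ≡ ratio ys
ratio-↭ xs↭ys = cong₂ _,_ (product-↭ xs↭ys) (product-↭ (map⁺ (_∸ 1) xs↭ys))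

module _ {P : Pred ℕ 0ℓ} (P? : Decidable P) where

  filter-partition-↭ : ∀ xs → xs ↭ filter P? xs ++ filter (¬? ∘ P?) xs
  filter-partition-↭ []       = refl
  filter-partition-↭ (x ∷ xs) with P? x
  ... | yes _ = prep x (filter-partition-↭ xs)
  ... | no  _ = ↭-trans (prep x (filter-partition-↭ xs)) (↭-sym (shift x _ _))

  ratio-partition : ∀ xs → ratio xs ≡ ratio (filter P? xs) ⊗ ratio (filter (¬? ∘ P?) xs)
  ratio-partition xs = trans (ratio-↭ (filter-partition-↭ xs)) (ratio-++ (filter P? xs) (filter (¬? ∘ P?) xs))

ratio-denominator≢0 : ∀ {xs} → All (2 ≤_) xs → NonZero (proj₂ (ratio xs))
ratio-denominator≢0 2≤xs = product≢0 (AllP.map⁺ (All.map (λ { (s≤s 1≤x) → >-nonZero 1≤x }) 2≤xs))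

ratio-unique-≡ : ∀ {c} xs → Unique xs → All (_≡ c) xs → ratio xs ≤ᶠ (c , c ∸ 1)
ratio-unique-≡ {c} []          _               _                 =
  *≤* (subst₂ _≤_ (sym (*-identityˡ (c ∸ 1))) (sym (*-identityʳ c)) (m∸n≤m c 1))
ratio-unique-≡ {c} (_ ∷ [])    _               (refl ∷ [])       =
  *≤* (≤-reflexive (m*n*o≡m*[o*n] c 1 (c ∸ 1)))
ratio-unique-≡     (_ ∷ _ ∷ _) ((x≢y ∷ _) ∷ _) (refl ∷ refl ∷ _) = contradiction refl x≢y

ratio-⊆ : ∀ {xs} ys → Unique xs → xs ⊆ ys → ratio xs ≤ᶠ ratio ys
ratio-⊆ {[]}    []       _   _     = *≤* ≤-refl
ratio-⊆ {_ ∷ _} []       _   xs⊆[] with () ← xs⊆[] (here refl)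
ratio-⊆ {xs}    (c ∷ ys) xs! xs⊆   = subst (_≤ᶠ ratio (c ∷ ys)) (sym (ratio-partition (_≟ c) xs))
  (⊗-mono-≤ᶠ (ratio-unique-≡ _ (Unique.filter⁺ (_≟ c) xs!) (AllP.all-filter (_≟ c) xs))
             (ratio-⊆ ys (Unique.filter⁺ (¬? ∘ (_≟ c)) xs!) others⊆ys))
  where
  others⊆ys : filter (¬? ∘ (_≟ c)) xs ⊆ ys
  others⊆ys x∈ with ∈-filter⁻ (¬? ∘ (_≟ c)) x∈
  ... | x∈xs , x≢c with xs⊆ x∈xs
  ...   | here x≡c   = contradiction x≡c x≢c
  ...   | there x∈ys = x∈ys

m/[m∸1]-antitone : ∀ {m n} → n ≤ m → (m , m ∸ 1) ≤ᶠ (n , n ∸ 1)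
m/[m∸1]-antitone {m}     {zero}  _         = *≤* (≤-reflexive (*-zeroʳ m))
m/[m∸1]-antitone {suc m} {suc n} (s≤s n≤m) = *≤* (+-mono-≤ n≤m (≤-reflexive (*-comm m n)))

ratio-map-antitone : ∀ {f g : ℕ → ℕ} → (∀ j → g j ≤ f j) → ∀ js →
                     ratio (map f js) ≤ᶠ ratio (map g js)
ratio-map-antitone g≤f []       = *≤* ≤-refl
ratio-map-antitone g≤f (j ∷ js) = ⊗-mono-≤ᶠ (m/[m∸1]-antitone (g≤f j)) (ratio-map-antitone g≤f js)

ratio-≤ᶠ-^ : ∀ {n} xs → All (n <_) xs → ratio xs ≤ᶠ (suc n ^ length xs , n ^ length xs)
ratio-≤ᶠ-^ []       []           = *≤* ≤-refl
ratio-≤ᶠ-^ (x ∷ xs) (n<x ∷ n<xs) = ⊗-mono-≤ᶠ (m/[m∸1]-antitone n<x) (ratio-≤ᶠ-^ xs n<xs)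

bernoulli : ∀ n k → suc n ^ k * (n ∸ k) ≤ n ^ suc k
bernoulli n zero    = ≤-reflexive (trans (+-identityʳ n) (sym (*-identityʳ n)))
bernoulli n (suc k) = begin
  suc n * suc n ^ k * (n ∸ suc k)     ≡⟨ m*n*o≡n*[m*o] (suc n) (suc n ^ k) (n ∸ suc k) ⟩
  suc n ^ k * (suc n * (n ∸ suc k))   ≡⟨ cong (λ t → suc n ^ k * (suc n * t)) (pred[m∸n]≡m∸[1+n] n k) ⟨
  suc n ^ k * (suc n * pred (n ∸ k))  ≤⟨ *-monoʳ-≤ (suc n ^ k) (step (n ∸ k) (m∸n≤m n k)) ⟩
  suc n ^ k * (n * (n ∸ k))           ≡⟨ m*[n*o]≡n*[m*o] (suc n ^ k) n (n ∸ k) ⟩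
  n * (suc n ^ k * (n ∸ k))           ≤⟨ *-monoʳ-≤ n (bernoulli n k) ⟩
  n * n ^ suc k                       ∎
  where
  open ≤-Reasoning
  step : ∀ m → m ≤ n → suc n * pred m ≤ n * m
  step zero    _   = ≤-refl
  step (suc m) m<n = begin
    m + n * m  ≤⟨ +-monoˡ-≤ (n * m) (<⇒≤ m<n) ⟩
    n + n * m  ≡⟨ *-suc n m ⟨
    n * suc m  ∎

bernoulli-ratio : ∀ {n} c k .{{_ : NonZero n}} → suc c * k ≤ n → (suc n ^ k , n ^ k) ≤ᶠ (suc c , c)
bernoulli-ratio {n} c k [1+c]k≤n = *≤* (*-cancelˡ-≤ n (begin
  n * (suc n ^ k * c)            ≡⟨ m*[n*o]≡n*[o*m] n (suc n ^ k) c ⟩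
  suc n ^ k * (c * n)            ≤⟨ *-monoʳ-≤ (suc n ^ k) cn≤[1+c][n∸k] ⟩
  suc n ^ k * (suc c * (n ∸ k))  ≡⟨ m*[n*o]≡n*[m*o] (suc n ^ k) (suc c) (n ∸ k) ⟩
  suc c * (suc n ^ k * (n ∸ k))  ≤⟨ *-monoʳ-≤ (suc c) (bernoulli n k) ⟩
  suc c * (n * n ^ k)            ≡⟨ m*[n*o]≡n*[m*o] (suc c) n (n ^ k) ⟩
  n * (suc c * n ^ k)            ∎))
  where
  open ≤-Reasoning
  cn≤[1+c][n∸k] : c * n ≤ suc c * (n ∸ k)
  cn≤[1+c][n∸k] = begin
    c * n                  ≡⟨ m+n∸m≡n n (c * n) ⟨
    suc c * n ∸ n          ≤⟨ ∸-monoʳ-≤ (suc c * n) [1+c]k≤n ⟩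
    suc c * n ∸ suc c * k  ≡⟨ *-distribˡ-∸ (suc c) n k ⟨
    suc c * (n ∸ k)        ∎

ratio-few-large : ∀ {n} c xs .{{_ : NonZero n}} → All (n <_) xs → suc c * length xs ≤ n →
                  ratio xs ≤ᶠ (suc c , c)
ratio-few-large {n} c xs n<xs [1+c]k≤n =
  ≤ᶠ-trans {{m^n≢0 n (length xs)}} (ratio-≤ᶠ-^ xs n<xs) (bernoulli-ratio c (length xs) [1+c]k≤n)

c²<n∧nᵏ≤cᵈ⇒2k≤d : ∀ {c n k d} .{{_ : NonZero d}} → c * c < n → n ^ k ≤ c ^ d → 2 * k ≤ d
c²<n∧nᵏ≤cᵈ⇒2k≤d {c} {n} {k} {d} c²<n nᵏ≤cᵈ with 2 * k ≤? d
... | yes 2k≤d = 2k≤d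
... | no  2k≰d = contradiction (begin-strict
  (c * c) ^ d    <⟨ ^-monoˡ-< d c²<n ⟩
  n ^ d          ≤⟨ ^-monoʳ-≤ n (<⇒≤ (≰⇒> 2k≰d)) ⟩
  n ^ (2 * k)    ≡⟨ cong (λ e → n ^ (k + e)) (+-identityʳ k) ⟩
  n ^ (k + k)    ≡⟨ ^-distribˡ-+-* n k k ⟩
  n ^ k * n ^ k  ≤⟨ *-mono-≤ nᵏ≤cᵈ nᵏ≤cᵈ ⟩
  c ^ d * c ^ d  ≡⟨ ^-distribʳ-* c c d ⟨
  (c * c) ^ d    ∎) (<-irrefl refl)
  where
  open ≤-Reasoning
  instance _ = >-nonZero (≤-<-trans z≤n c²<n)

^length≤product : ∀ {m} xs → All (m ≤_) xs → m ^ length xs ≤ product xs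
^length≤product []       []           = ≤-refl
^length≤product (x ∷ xs) (m≤x ∷ m≤xs) = *-mono-≤ m≤x (^length≤product xs m≤xs)

ratio-few-large-≤ᶠ-128/127 : ∀ d xs → 100 ≤ d → All (64 * d <_) xs → product xs ≤ 80 ^ d →
                             ratio xs ≤ᶠ (128 , 127)
ratio-few-large-≤ᶠ-128/127 d xs 100≤d 64d<xs ∏xs≤80ᵈ = ratio-few-large 127 xs 64d<xs (begin
  128 * length xs       ≡⟨ *-assoc 64 2 (length xs) ⟩
  64 * (2 * length xs)  ≤⟨ *-monoʳ-≤ 64 (c²<n∧nᵏ≤cᵈ⇒2k≤d {k = length xs} 80²<1+64d [1+64d]ᵏ≤80ᵈ) ⟩
  64 * d                ∎)
  where
  open ≤-Reasoning
  instance
    d≢0 : NonZero d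
    d≢0 = >-nonZero (≤-trans (s≤s z≤n) 100≤d)
    64d≢0 : NonZero (64 * d)
    64d≢0 = m*n≢0 64 d
  80²<1+64d : 80 * 80 < suc (64 * d)
  80²<1+64d = s≤s (*-monoʳ-≤ 64 100≤d)
  [1+64d]ᵏ≤80ᵈ : suc (64 * d) ^ length xs ≤ 80 ^ d
  [1+64d]ᵏ≤80ᵈ = ≤-trans (^length≤product xs 64d<xs) ∏xs≤80ᵈ

-- Opaque, since unification would otherwise unfold the product of 31 symbolic factors,
-- which takes exponential time.
opaque
  candidates : ℕ → ℕ → List ℕ
  candidates d K = map (λ j → suc (2 * d * suc j)) (upTo K)

  ∈-candidates : ∀ {d x} K → 2 ≤ x → 2 * d ∣ x ∸ 1 → x ≤ 2 * d * suc K → x ∈ candidates d K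
  ∈-candidates {d} {suc x} K (s≤s 1≤x) (divides zero    x≡0)       _            =
    contradiction (≤-trans 1≤x (≤-reflexive x≡0)) λ ()
  ∈-candidates {d} {suc x} K _         (divides (suc i) x≡[1+i]2d) 1+x≤2d[1+K] =
    subst (_∈ candidates d K) (cong suc (trans (*-comm (2 * d) (suc i)) (sym x≡[1+i]2d)))
          (∈-map⁺ (λ j → suc (2 * d * suc j)) (∈-upTo⁺ (≤-pred 1+i<1+K)))
    where
    1+i<1+K : suc i < suc K
    1+i<1+K = *-cancelʳ-< (2 * d) (suc i) (suc K)
      (subst₂ _<_ x≡[1+i]2d (*-comm (2 * d) (suc K)) 1+x≤2d[1+K])

  candidates-antitone : ∀ {d₀ d} K → d₀ ≤ d → ratio (candidates d K) ≤ᶠ ratio (candidates d₀ K)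
  candidates-antitone K d₀≤d =
    ratio-map-antitone (λ j → s≤s (*-monoˡ-≤ (suc j) (*-monoʳ-≤ 2 d₀≤d))) (upTo K)

  candidates-denominator≢0 : ∀ d K .{{_ : NonZero d}} → NonZero (proj₂ (ratio (candidates d K)))
  candidates-denominator≢0 d K = ratio-denominator≢0 (AllP.map⁺ (All.universal 2≤candidate (upTo K)))
    where
    2≤candidate : ∀ j → 2 ≤ suc (2 * d * suc j)
    2≤candidate j = s≤s (*-mono-≤ (*-mono-≤ {1} {2} (s≤s z≤n) (>-nonZero⁻¹ d)) (s≤s z≤n))

  candidates-ratio-bound : ratio (candidates 173 31) ⊗ (128 , 127) <ᶠ (129 , 125)
  candidates-ratio-bound = *<* (toWitness {a? = _ <? _} _)

ratio-≤ᶠ-candidates : ∀ {d₀} d xs → d₀ ≤ d → 100 ≤ d → Unique xs →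
                      All (λ x → 2 ≤ x × 2 * d ∣ x ∸ 1) xs → product xs ≤ 80 ^ d →
                      ratio xs ≤ᶠ ratio (candidates d₀ 31) ⊗ (128 , 127)
ratio-≤ᶠ-candidates {d₀} d xs d₀≤d 100≤d xs! shape ∏xs≤80ᵈ =
  subst (_≤ᶠ ratio (candidates d₀ 31) ⊗ (128 , 127)) (sym (ratio-partition small? xs))
        (⊗-mono-≤ᶠ small-bound large-bound)
  where
  instance
    d≢0 : NonZero d
    d≢0 = >-nonZero (≤-trans (s≤s z≤n) 100≤d)
  small? = _≤? 64 * d
  small = filter small? xs
  large = filter (¬? ∘ small?) xs
  small⊆candidates : small ⊆ candidates d 31
  small⊆candidates x∈small with ∈-filter⁻ small? x∈small
  ... | x∈xs , x≤64d with All.lookup shape x∈xs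
  ...   | 2≤x , 2d∣x∸1 =
    ∈-candidates 31 2≤x 2d∣x∸1 (≤-trans x≤64d (≤-reflexive (m*n*o≡m*o*n 2 32 d)))
  small-bound : ratio small ≤ᶠ ratio (candidates d₀ 31)
  small-bound = ≤ᶠ-trans {{candidates-denominator≢0 d 31}}
    (ratio-⊆ (candidates d 31) (Unique.filter⁺ small? xs!) small⊆candidates)
    (candidates-antitone 31 d₀≤d)
  ∏large≤80ᵈ : product large ≤ 80 ^ d
  ∏large≤80ᵈ = begin
    product large                  ≤⟨ m≤n*m (product large) (product small) {{∏small≢0}} ⟩
    product small * product large  ≡⟨ cong proj₁ (ratio-partition small? xs) ⟨
    product xs                     ≤⟨ ∏xs≤80ᵈ ⟩
    80 ^ d                         ∎
    where
    open ≤-Reasoning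
    ∏small≢0 : NonZero (product small)
    ∏small≢0 = product≢0 (All.map (λ 2≤x → >-nonZero (≤-trans (s≤s z≤n) 2≤x))
                                  (AllP.filter⁺ small? (All.map proj₁ shape)))
  large-bound : ratio large ≤ᶠ (128 , 127)
  large-bound = ratio-few-large-≤ᶠ-128/127 d large 100≤d
                  (All.map ≰⇒> (AllP.all-filter (¬? ∘ small?) xs)) ∏large≤80ᵈ

ratio<ᶠ129/125 : ∀ d xs → 173 ≤ d → Unique xs → All (λ x → 2 ≤ x × 2 * d ∣ x ∸ 1) xs →
                 product xs ≤ 80 ^ d → ratio xs <ᶠ (129 , 125)
ratio<ᶠ129/125 d xs 173≤d xs! shape ∏xs≤80ᵈ =
  ≤ᶠ-<ᶠ-trans {{ratio-denominator≢0 (All.map proj₁ shape)}}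
              {{m*n≢0 _ 127 {{candidates-denominator≢0 173 31}}}}
    (ratio-≤ᶠ-candidates d xs 173≤d (≤-trans (m≤m+n 100 73) 173≤d) xs! shape ∏xs≤80ᵈ)
    candidates-ratio-bound

-- Passing to the rationals

infix 4 _≃ᶠ_

data _≃ᶠ_ : ℚᵘ → ℕ × ℕ → Set where
  *≡* : ∀ {u a b} → ↥ u ℤ.* + b ≡ + a ℤ.* ↧ u → u ≃ᶠ (a , b)

≃ᶠ-* : ∀ {u v a b c d} → u ≃ᶠ (a , b) → v ≃ᶠ (c , d) → u ℚᵘ.* v ≃ᶠ (a , b) ⊗ (c , d)
≃ᶠ-* {u@record{}} {v@record{}} {a} {b} {c} {d} (*≡* ub≡au) (*≡* vd≡cv) = *≡* (begin
  ↥ u ℤ.* ↥ v ℤ.* + (b * d)            ≡⟨ cong (ℤ._*_ (↥ u ℤ.* ↥ v)) (ℤP.pos-* b d) ⟩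
  ↥ u ℤ.* ↥ v ℤ.* (+ b ℤ.* + d)        ≡⟨ ℤ*.interchange (↥ u) (↥ v) (+ b) (+ d) ⟩
  (↥ u ℤ.* + b) ℤ.* (↥ v ℤ.* + d)      ≡⟨ cong₂ ℤ._*_ ub≡au vd≡cv ⟩
  (+ a ℤ.* ↧ u) ℤ.* (+ c ℤ.* ↧ v)      ≡⟨ ℤ*.interchange (+ a) (↧ u) (+ c) (↧ v) ⟩
  (+ a ℤ.* + c) ℤ.* (↧ u ℤ.* ↧ v)      ≡⟨ cong₂ ℤ._*_ (ℤP.pos-* a c) (ℤP.pos-* (↧ₙ u) (↧ₙ v)) ⟨
  + (a * c) ℤ.* + (↧ₙ u * ↧ₙ v)        ∎)
  where open ≡-Reasoning

≃ᶠ-resp-≃ : ∀ {u v x} → u ℚᵘ.≃ v → u ≃ᶠ x → v ≃ᶠ x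
≃ᶠ-resp-≃ {u} {v} {a , b} (ℚᵘ.*≡* u↧v≡v↧u) (*≡* ub≡au) =
  *≡* (ℤP.*-cancelʳ-≡ _ _ (↧ u) (begin
  ↥ v ℤ.* + b ℤ.* ↧ u  ≡⟨ ℤ*.xy∙z≈xz∙y (↥ v) (+ b) (↧ u) ⟩
  ↥ v ℤ.* ↧ u ℤ.* + b  ≡⟨ cong (ℤ._* + b) u↧v≡v↧u ⟨
  ↥ u ℤ.* ↧ v ℤ.* + b  ≡⟨ ℤ*.xy∙z≈xz∙y (↥ u) (↧ v) (+ b) ⟩
  ↥ u ℤ.* + b ℤ.* ↧ v  ≡⟨ cong (ℤ._* ↧ v) ub≡au ⟩
  + a ℤ.* ↧ u ℤ.* ↧ v  ≡⟨ ℤ*.xy∙z≈xz∙y (+ a) (↧ u) (↧ v) ⟩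
  + a ℤ.* ↧ v ℤ.* ↧ u  ∎))
  where open ≡-Reasoning

≃ᶠ-<ᶠ⇒< : ∀ {u a b c d} .{{_ : NonZero b}} → u ≃ᶠ (a , b) → (a , b) <ᶠ (c , suc d) → u ℚᵘ.< mkℚᵘ (+ c) d
≃ᶠ-<ᶠ⇒< {u@record{}} {a} {b} {c} {d} (*≡* ub≡au) (*<* a[1+d]<cb) =
  ℚᵘ.*<* (ℤP.*-cancelʳ-<-nonNeg (+ b) (begin-strict
  ↥ u ℤ.* + suc d ℤ.* + b  ≡⟨ ℤ*.xy∙z≈xz∙y (↥ u) (+ suc d) (+ b) ⟩
  ↥ u ℤ.* + b ℤ.* + suc d  ≡⟨ cong (ℤ._* + suc d) ub≡au ⟩
  + a ℤ.* ↧ u ℤ.* + suc d  ≡⟨ ℤ*.xy∙z≈xz∙y (+ a) (↧ u) (+ suc d) ⟩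
  + a ℤ.* + suc d ℤ.* ↧ u  ≡⟨ cong (ℤ._* ↧ u) (ℤP.pos-* a (suc d)) ⟨
  + (a * suc d) ℤ.* ↧ u    <⟨ ℤP.*-monoʳ-<-pos (↧ u) (ℤ.+<+ a[1+d]<cb) ⟩
  + (c * b) ℤ.* ↧ u        ≡⟨ cong (ℤ._* ↧ u) (ℤP.pos-* c b) ⟩
  + c ℤ.* + b ℤ.* ↧ u      ≡⟨ ℤ*.xy∙z≈xz∙y (+ c) (+ b) (↧ u) ⟩
  + c ℤ.* ↧ u ℤ.* + b      ∎))
  where open ℤP.≤-Reasoning

toℚᵘ-1+1/n≃ᶠ : ∀ k → toℚᵘ (1ℚ ℚ.+ recipℚ (suc k)) ≃ᶠ (suc (suc k) , suc k)
toℚᵘ-1+1/n≃ᶠ k = ≃ᶠ-resp-≃ (ℚᵘP.≃-sym toℚᵘ-sum) (*≡* cross)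
  where
  sumᵘ = toℚᵘ 1ℚ ℚᵘ.+ mkℚᵘ (+ 1) k
  toℚᵘ-sum : toℚᵘ (1ℚ ℚ.+ recipℚ (suc k)) ℚᵘ.≃ sumᵘ
  toℚᵘ-sum = ℚᵘP.≃-trans (ℚP.toℚᵘ-homo-+ 1ℚ (recipℚ (suc k)))
                         (ℚᵘP.+-congʳ (toℚᵘ 1ℚ) (ℚP.toℚᵘ-fromℚᵘ (mkℚᵘ (+ 1) k)))
  cross : ↥ sumᵘ ℤ.* + suc k ≡ + suc (suc k) ℤ.* ↧ sumᵘ
  cross rewrite +-identityʳ k = cong (λ m → + suc (k + m * suc k)) (+-comm k 1)

toℚᵘ-prodFactor≃ᶠratio : ∀ xs → All (2 ≤_) xs → toℚᵘ (prodFactor xs) ≃ᶠ ratio xs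
toℚᵘ-prodFactor≃ᶠratio []                 []           = *≡* refl
toℚᵘ-prodFactor≃ᶠratio (suc zero ∷ _)     (s≤s () ∷ _)
toℚᵘ-prodFactor≃ᶠratio (suc (suc k) ∷ xs) (_ ∷ 2≤xs)   =
  ≃ᶠ-resp-≃ (ℚᵘP.≃-sym (ℚP.toℚᵘ-homo-* (1ℚ ℚ.+ recipℚ (suc k)) (prodFactor xs)))
            (≃ᶠ-* (toℚᵘ-1+1/n≃ᶠ k) (toℚᵘ-prodFactor≃ᶠratio xs 2≤xs))

-- The witness is the first partial sum 1 + 4/125 = 129/125 of the exponential series.
logLt-prodFactor : ∀ xs → All (2 ≤_) xs → ratio xs <ᶠ (129 , 125) → LogLt (prodFactor xs) ((+ 4) / 125)
logLt-prodFactor xs 2≤xs ratio<129/125 = 1 , ℚP.toℚᵘ-cancel-<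
  (≃ᶠ-<ᶠ⇒< {{ratio-denominator≢0 2≤xs}} (toℚᵘ-prodFactor≃ᶠratio xs 2≤xs) ratio<129/125)

div-≤ : ∀ m g → m div g ≤ m
div-≤ m zero    = z≤n
div-≤ m (suc g) = m/n≤m m (suc g)

div-mono-< : ∀ {m n g} → g ∣ m → g ∣ n → n < m → n div g < m div g
div-mono-< {g = zero}  0∣m _   n<m = contradiction (subst (_ <_) (0∣⇒≡0 0∣m) n<m) n≮0
div-mono-< {m} {n} {suc g} g∣m g∣n n<m =
  *-cancelʳ-< (suc g) (n div suc g) (m div suc g)
    (subst₂ _<_ (sym (m/n*n≡m g∣n)) (sym (m/n*n≡m g∣m)) n<m)

lemma11 : (x y z m n : ℕ) → 1 ≤ y → y < x → 1 ≤ z → 1 ≤ m → 1 ≤ n →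
    ¬ ((z ≡ 1) × (m ≡ 1) × (n ≡ 1)) →
    φ (z * U x y m) ≡ z * U x y n →
    z ≤ x ∸ y → gcd m n ≡ 1 →
    x ≤ 80 →
    (d : ℕ) → d ∣ m → (q : ℕ) → IsLeastPrimeDivisor q d → 173 ≤ q →
    (L : List ℕ) → Unique L →
    (∀ p → (p ∈ L) ⇔
      (Prime p × p ≢ 2 ×
       ¬ (p ∣ ((x div gcd x y) * (y div gcd x y))) ×
       IsLeastOrder (x div gcd x y) (y div gcd x y) p d)) →
    LogLt (prodFactor L) ((+ 4) / 125)
lemma11 x y _ m _ _ y<x _ 1≤m _ _ _ _ _ x≤80 d d∣m _ (_ , q∣d , q-least) 173≤q L L! L-spec =
  logLt-prodFactor L (All.map proj₁ shape) (ratio<ᶠ129/125 d L 173≤d L! shape ∏L≤80ᵈ)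
  where
  a = x div gcd x y
  b = y div gcd x y
  b<a : b < a
  b<a = div-mono-< (gcd[m,n]∣m x y) (gcd[m,n]∣n x y) y<x
  instance
    d≢0 : NonZero d
    d≢0 = ∣-nonZero {{>-nonZero 1≤m}} d∣m
  173≤d : 173 ≤ d
  173≤d = ≤-trans 173≤q (∣⇒≤ q∣d)
  2∤d : ¬ 2 ∣ d
  2∤d 2∣d = <⇒≱ (m≤m+n 3 170) (≤-trans 173≤q (q-least 2 prime[2] 2∣d))
  members : All (λ p → Prime p × p ≢ 2 × ¬ p ∣ a * b × IsLeastOrder a b p d) L
  members = All.tabulate (Equivalence.to (L-spec _))
  shape : All (λ p → 2 ≤ p × 2 * d ∣ p ∸ 1) L
  shape = All.map (λ (p-prime , p≢2 , p∤ab , order) →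
    prime⇒2≤ p-prime , leastOrder⇒2d∣p∸1 p-prime 2∤d p≢2 p∤ab (<⇒≤ b<a) order) members
  ∏L≤80ᵈ : product L ≤ 80 ^ d
  ∏L≤80ᵈ = product-distinctPrimes-≤ b<a (≤-trans (div-≤ x (gcd x y)) x≤80) L!
    (All.map proj₁ members) (All.map (λ (_ , _ , _ , _ , p∣aᵈ∸bᵈ , _) → p∣aᵈ∸bᵈ) members)
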